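{- Let $T$ be a finite tree. The minority process has an independent fixed point on $T$; it has a fixed point that is not independent if and only if $T$ has at least two inner nodes. The majority process has a monochromatic fixed point on $T$; it has a fixed point that is not monochromatic if and only if $T$ has at least two inner nodes.
   Context: Colorings are maps $c:V\to\{0,1\}$; $N^i(v)$ is the set of neighbors of $v$ with color $i$. Minority: $\mathcal{MIN}(c)(v)=c(v)$ if $|N^{c(v)}(v)|\le|N^{1-c(v)}(v)|$, else $1-c(v)$; majority: $\mathcal{MAJ}(c)(v)=c(v)$ if $|N^{c(v)}(v)|\ge|N^{1-c(v)}(v)|$, else $1-c(v)$. A fixed point is a coloring $c$ with $\mathcal{M}(c)=c$. A coloring is monochromatic if all nodes have the same color, independent if each node's color differs from all its neighbors' colors. An inner node is a node of degree at least $2$. -}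

module Defs where

open import Data.Nat using (ℕ; _≤_; _<_)
open import Data.Bool using (Bool; true; false; not; _∧_)
open import Data.Fin using (Fin)
open import Data.List using (List; []; _∷_; length; filter; _∷ʳ_)
open import Data.List.Relation.Unary.Linked using (Linked)
open import Data.List.Relation.Unary.Unique.Propositional using (Unique)
open import Data.Fin.Base using () 
open import Data.List.Base using ()
open import Data.Fin.Base using ()
open import Data.List using ()
open import Data.Product using (Σ; _×_; ∃; ∃-syntax)
open import Relation.Nullary using (¬_)
open import Relation.Nullary.Decidable using (⌊_⌋)
open import Relation.Binary.PropositionalEquality using (_≡_; _≢_)
open import Data.Bool.Properties using () renaming (_≟_ to _≟ᵇ_)
open import Data.List using (allFin)

record Graph (n : ℕ) : Set where
  field
    adj       : Fin n → Fin n → Bool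
    adj-sym   : ∀ u v → adj u v ≡ adj v u
    adj-irrefl : ∀ v → adj v v ≡ false
open Graph public

module _ {n : ℕ} (G : Graph n) where

  Adj : Fin n → Fin n → Set
  Adj u v = adj G u v ≡ true

  data Walk : Fin n → Fin n → Set where
    here : ∀ {v} → Walk v v
    step : ∀ {u w v} → Adj u w → Walk w v → Walk u v

  Connected : Set
  Connected = ∀ u v → Walk u v

  IsCycle : List (Fin n) → Set
  IsCycle [] = Data.Empty.⊥
    where import Data.Empty
  IsCycle (x ∷ xs) =
    (2 ≤ length xs) × Unique (x ∷ xs) × Linked Adj ((x ∷ xs) ∷ʳ x)

  Acyclic : Set
  Acyclic = ∀ cs → ¬ IsCycle cs

  IsTree : Set
  IsTree = (0 < n) × Connected × Acyclic

  Coloring : Set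
  Coloring = Fin n → Bool

  N : Coloring → Bool → Fin n → List (Fin n)
  N c i v = filter (λ u → adj G v u ≟ᵇ true) (filter (λ u → c u ≟ᵇ i) (allFin n))

  degree : Fin n → ℕ
  degree v = length (filter (λ u → adj G v u ≟ᵇ true) (allFin n))

  InnerNode : Fin n → Set
  InnerNode v = 2 ≤ degree v

  AtLeastTwoInnerNodes : Set
  AtLeastTwoInnerNodes = ∃[ u ] ∃[ v ] (u ≢ v × InnerNode u × InnerNode v)

  MIN : Coloring → Coloring
  MIN c v = if ⌊ length (N c (c v) v) Data.Nat.≤? length (N c (not (c v)) v) ⌋
            then c v else not (c v)
    where open import Data.Bool using (if_then_else_)
          import Data.Nat

  MAJ : Coloring → Coloring
  MAJ c v = if ⌊ length (N c (not (c v)) v) Data.Nat.≤? length (N c (c v) v) ⌋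
            then c v else not (c v)
    where open import Data.Bool using (if_then_else_)
          import Data.Nat

  FixedPoint : (Coloring → Coloring) → Coloring → Set
  FixedPoint M c = ∀ v → M c v ≡ c v

  Monochromatic : Coloring → Set
  Monochromatic c = ∀ u v → c u ≡ c v

  Independent : Coloring → Set
  Independent c = ∀ u v → Adj u v → c u ≢ c v

{-# OPTIONS --safe #-}

-- A symmetric edge labelling ℓ of a tree is the pattern of colour changes of a
-- colouring, its potential (the xor of ℓ along a walk from a root), because closed
-- walks in a tree have xor-weight zero. Changing colour along every edge gives an
-- independent MIN fixed point, and a constant colouring is a monochromatic MAJ fixed
-- point. Given an edge xy between inner nodes, changing colour along every edge but
-- xy (for MIN), resp. along xy only (for MAJ), leaves x and y with exactly one
-- offending neighbour among at least two and every other node with none. Conversely,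
-- in a fixed point an offending edge forces each endpoint to have a compensating
-- second neighbour, so both endpoints are inner; and in a connected graph two
-- distinct inner nodes exist iff two adjacent ones do.

module Submission where

open import Defs
open import Data.Bool using (Bool; true; false; not; _xor_; if_then_else_)
open import Data.Bool.Properties
  using (not-involutive; not-injective; not-¬; ¬-not; xor-same; xor-assoc; xor-identityʳ; xor-inverseʳ)
  renaming (_≟_ to _≟ᵇ_)
open import Data.Empty using (⊥-elim)
open import Data.Fin using (Fin; fromℕ<)
open import Data.Fin.Properties using (any?) renaming (_≟_ to _≟ᶠ_)
open import Data.List using (List; []; _∷_; length; filter; allFin; _∷ʳ_)
open import Data.List.Membership.Propositional using (_∈_; _∉_)
open import Data.List.Membership.Propositional.Properties
  using (∈-filter⁺; ∈-filter⁻; ∈-allFin; ∈-length)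
open import Data.List.Relation.Unary.All using (_∷_)
open import Data.List.Relation.Unary.All.Properties using (¬Any⇒All¬)
open import Data.List.Relation.Unary.AllPairs using ([]; _∷_)
open import Data.List.Relation.Unary.Any using (here; there) renaming (any? to anyᴸ?)
open import Data.List.Relation.Unary.Linked using (Linked; [-]; _∷_)
open import Data.List.Relation.Unary.Unique.Propositional using (Unique)
open import Data.List.Relation.Unary.Unique.Propositional.Properties
  using (allFin⁺; filter⁺)
open import Data.Nat using (ℕ; suc; _+_; _≤_; _<_; _≤?_; z≤n; s≤s)
open import Data.Nat.Induction using (<-wellFounded)
open import Data.Nat.Properties
  using (+-suc; ≤-trans; ≤-pred; +-mono-≤; +-monoˡ-≤; m≤n+m; m<m+n; m<n⇒m<1+n)
open import Data.Product using (∃-syntax; _×_; _,_; proj₁; proj₂; swap)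
open import Data.Sum using (_⊎_; inj₁; inj₂; [_,_])
open import Function using (_∘_)
open import Function.Bundles using (_⇔_; mk⇔; Equivalence)
open import Function.Properties.Equivalence using () renaming (trans to ⇔-trans)
open import Induction.WellFounded using (Acc; acc)
open import Level using (0ℓ)
open import Relation.Nullary using (¬_; Dec; yes; no; does)
open import Relation.Nullary.Decidable using (⌊_⌋; ¬?; _×-dec_; _⊎-dec_; dec-true; does-⇔)
open import Relation.Unary using (Pred; Decidable)
open import Relation.Binary.PropositionalEquality
  using (_≡_; _≢_; refl; sym; trans; cong; cong₂; subst; module ≡-Reasoning)

xor≡false⇒≡ : ∀ {x y} → x xor y ≡ false → x ≡ y
xor≡false⇒≡ {false} {false} _ = refl
xor≡false⇒≡ {true}  {true}  _ = refl

xor≡true⇒≢ : ∀ {x y} → x xor y ≡ true → x ≢ y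
xor≡true⇒≢ {x} e refl with trans (sym (xor-same x)) e
... | ()

xor-rotate : ∀ x y z → x xor (y xor z) ≡ y xor (x xor z)
xor-rotate false false z = refl
xor-rotate false true  z = refl
xor-rotate true  false z = refl
xor-rotate true  true  z = refl

does-true⇒ : ∀ {P : Set} (d : Dec P) → does d ≡ true → P
does-true⇒ (yes p) _ = p

if-then-else-not≡⇔ : ∀ {P : Set} (d : Dec P) b → ((if ⌊ d ⌋ then b else not b) ≡ b) ⇔ P
if-then-else-not≡⇔ (yes p) b = mk⇔ (λ _ → p) (λ _ → refl)
if-then-else-not≡⇔ (no ¬p) b = mk⇔ (λ e → ⊥-elim (not-¬ refl (sym e))) (⊥-elim ∘ ¬p)

∀-⇔ : ∀ {A : Set} {P Q : A → Set} → (∀ x → P x ⇔ Q x) → (∀ x → P x) ⇔ (∀ x → Q x)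
∀-⇔ P⇔Q = mk⇔ (λ p x → Equivalence.to (P⇔Q x) (p x)) (λ q x → Equivalence.from (P⇔Q x) (q x))

module _ {A : Set} where

  length≡0 : {xs : List A} → (∀ {x} → x ∉ xs) → length xs ≡ 0
  length≡0 {[]}    _    = refl
  length≡0 {_ ∷ _} none = ⊥-elim (none (here refl))

  length≤1 : {xs : List A} {y : A} → Unique xs → (∀ {x} → x ∈ xs → x ≡ y) → length xs ≤ 1
  length≤1 {[]}        _                 _    = z≤n
  length≤1 {_ ∷ []}    _                 _    = s≤s z≤n
  length≤1 {_ ∷ _ ∷ _} ((x≢x′ ∷ _) ∷ _) only =
    ⊥-elim (x≢x′ (trans (only (here refl)) (sym (only (there (here refl))))))

  2≤length : {xs : List A} {x y : A} → x ∈ xs → y ∈ xs → x ≢ y → 2 ≤ length xs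
  2≤length (here refl) (here refl) x≢y = ⊥-elim (x≢y refl)
  2≤length (here _)    (there y∈)  _   = s≤s (∈-length y∈)
  2≤length (there x∈)  (here _)    _   = s≤s (∈-length x∈)
  2≤length (there x∈)  (there y∈)  x≢y = m<n⇒m<1+n (2≤length x∈ y∈ x≢y)

  length-filter-colour-split : {P : Pred A 0ℓ} (P? : Decidable P) (c : A → Bool) (i : Bool) (xs : List A) →
    length (filter P? (filter (λ x → c x ≟ᵇ i) xs)) + length (filter P? (filter (λ x → c x ≟ᵇ not i) xs))
      ≡ length (filter P? xs)
  length-filter-colour-split P? c i [] = refl
  length-filter-colour-split P? c i (x ∷ xs) with c x ≟ᵇ i | c x ≟ᵇ not i
  ... | yes refl | yes e   = ⊥-elim (not-¬ refl e)
  ... | no c≢i   | no c≢¬i = ⊥-elim (c≢¬i (¬-not c≢i))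
  ... | yes _    | no _    with does (P? x)
  ...   | false = length-filter-colour-split P? c i xs
  ...   | true  = cong suc (length-filter-colour-split P? c i xs)
  length-filter-colour-split P? c i (x ∷ xs) | no _ | yes _ with does (P? x)
  ...   | false = length-filter-colour-split P? c i xs
  ...   | true  = trans (+-suc _ _) (cong suc (length-filter-colour-split P? c i xs))

module _ {n : ℕ} (G : Graph n) where

  Adj-sym : ∀ {u v} → Adj G u v → Adj G v u
  Adj-sym {u} {v} a = trans (adj-sym G v u) a

  Adj⇒≢ : ∀ {u v} → Adj G u v → u ≢ v
  Adj⇒≢ {u} a refl with trans (sym a) (adj-irrefl G u)
  ... | ()

  neighbours : Fin n → List (Fin n)
  neighbours v = filter (λ u → adj G v u ≟ᵇ true) (allFin n)

  ∈-neighbours : ∀ {u v} → Adj G v u → u ∈ neighbours v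
  ∈-neighbours a = ∈-filter⁺ _ (∈-allFin _) a

  inner-of-two-neighbours : ∀ {v u w} → Adj G v u → Adj G v w → u ≢ w → InnerNode G v
  inner-of-two-neighbours a b = 2≤length (∈-neighbours a) (∈-neighbours b)

  InnerEdge : Set
  InnerEdge = ∃[ x ] ∃[ y ] (Adj G x y × InnerNode G x × InnerNode G y)

  module _ {c : Coloring G} {i : Bool} {v : Fin n} where

    ∈-N⁺ : ∀ {u} → Adj G v u → c u ≡ i → u ∈ N G c i v
    ∈-N⁺ a e = ∈-filter⁺ _ (∈-filter⁺ _ (∈-allFin _) e) a

    ∈-N⁻ : ∀ {u} → u ∈ N G c i v → Adj G v u × c u ≡ i
    ∈-N⁻ m with ∈-filter⁻ (λ u → adj G v u ≟ᵇ true) {xs = filter (λ u → c u ≟ᵇ i) (allFin n)} m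
    ... | m′ , a = a , proj₂ (∈-filter⁻ (λ u → c u ≟ᵇ i) {xs = allFin n} m′)

    N-unique : Unique (N G c i v)
    N-unique = filter⁺ (λ u → adj G v u ≟ᵇ true) (filter⁺ (λ u → c u ≟ᵇ i) (allFin⁺ n))

    length-N-split : length (N G c i v) + length (N G c (not i) v) ≡ degree G v
    length-N-split = length-filter-colour-split _ c i (allFin n)

  InMinority : Coloring G → Bool → Fin n → Set
  InMinority c i v = length (N G c i v) ≤ length (N G c (not i) v)

  MIN-fixed⇔ : ∀ c → FixedPoint G (MIN G) c ⇔ (∀ v → InMinority c (c v) v)
  MIN-fixed⇔ c = ∀-⇔ λ v → if-then-else-not≡⇔ (_ ≤? _) (c v)

  MAJ-fixed⇔ : ∀ c → FixedPoint G (MAJ G) c ⇔ (∀ v → InMinority c (not (c v)) v)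
  MAJ-fixed⇔ c = ∀-⇔ stable
    where
      stable : ∀ v → (MAJ G c v ≡ c v) ⇔ InMinority c (not (c v)) v
      stable v rewrite not-involutive (c v) = if-then-else-not≡⇔ (_ ≤? _) (c v)

  module _ {c : Coloring G} {i : Bool} {v : Fin n} where

    minority-of-absent : (∀ u → Adj G v u → c u ≢ i) → InMinority c i v
    minority-of-absent none = subst (_≤ length (N G c (not i) v)) (sym no-neighbour) z≤n
      where no-neighbour = length≡0 λ m → let (a , e) = ∈-N⁻ m in none _ a e

    minority-of-inner : ∀ {y} → InnerNode G v → (∀ u → Adj G v u → c u ≡ i → u ≡ y) → InMinority c i v
    minority-of-inner inner only-y = ≤-trans at-most-one (≤-pred (≤-trans two≤deg (+-monoˡ-≤ _ at-most-one)))
      where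
        at-most-one = length≤1 N-unique λ m → let (a , e) = ∈-N⁻ m in only-y _ a e
        two≤deg = subst (2 ≤_) (sym length-N-split) inner

    inner-of-minority : ∀ {u} → InMinority c i v → Adj G v u → c u ≡ i → InnerNode G v
    inner-of-minority minority a e = subst (2 ≤_) length-N-split (+-mono-≤ one≤ (≤-trans one≤ minority))
      where one≤ = ∈-length (∈-N⁺ a e)

  infixr 5 _++ʷ_

  _++ʷ_ : ∀ {u w v} → Walk G u w → Walk G w v → Walk G u v
  here     ++ʷ W′ = W′
  step a W ++ʷ W′ = step a (W ++ʷ W′)

  steps : ∀ {u v} → Walk G u v → ℕ
  steps here       = 0
  steps (step _ W) = suc (steps W)

  -- omits the endpoint: for a closed walk this is the vertex list IsCycle expects
  departures : ∀ {u v} → Walk G u v → List (Fin n)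
  departures here           = []
  departures (step {u} _ W) = u ∷ departures W

  weight : (Fin n → Fin n → Bool) → ∀ {u v} → Walk G u v → Bool
  weight ℓ here               = false
  weight ℓ (step {u} {w} _ W) = ℓ u w xor weight ℓ W

  steps-++ : ∀ {u w v} (W : Walk G u w) (W′ : Walk G w v) → steps (W ++ʷ W′) ≡ steps W + steps W′
  steps-++ here       W′ = refl
  steps-++ (step _ W) W′ = cong suc (steps-++ W W′)

  weight-++ : ∀ ℓ {u w v} (W : Walk G u w) (W′ : Walk G w v) →
    weight ℓ (W ++ʷ W′) ≡ weight ℓ W xor weight ℓ W′
  weight-++ ℓ here               W′ = refl
  weight-++ ℓ (step {u} {w} _ W) W′ = trans (cong (ℓ u w xor_) (weight-++ ℓ W W′)) (sym (xor-assoc (ℓ u w) _ _))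

  departures-linked : ∀ {u v} (W : Walk G u v) → Linked (Adj G) (departures W ∷ʳ v)
  departures-linked here                  = [-]
  departures-linked (step a here)         = a ∷ [-]
  departures-linked (step a W@(step _ _)) = a ∷ departures-linked W

  data Visits (x : Fin n) {u v : Fin n} : Walk G u v → Set where
    split : ∀ {y} (W : Walk G u x) (b : Adj G x y) (W′ : Walk G y v) → Visits x (W ++ʷ step b W′)

  visits : ∀ {x u v} (W : Walk G u v) → x ∈ departures W → Visits x W
  visits (step b W) (here refl) = split here b W
  visits (step a W) (there x∈)  with visits W x∈
  ... | split W₁ b W₂ = split (step a W₁) b W₂

  record Shortcut {u v : Fin n} (W : Walk G u v) : Set where
    field
      {base} : Fin n
      loop   : Walk G base base
      rest   : Walk G u v
      weight-split : ∀ ℓ → weight ℓ W ≡ weight ℓ loop xor weight ℓ rest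
      loop<  : steps loop < steps W
      rest<  : steps rest < steps W

  path-or-shortcut : ∀ {u v} (W : Walk G u v) → Unique (departures W) ⊎ Shortcut W
  path-or-shortcut here = inj₁ []
  path-or-shortcut (step {u} {w} a W) with path-or-shortcut W
  ... | inj₂ s = inj₂ (record
    { loop = loop ; rest = step a rest
    ; weight-split = λ ℓ → trans (cong (ℓ u w xor_) (weight-split ℓ))
                                 (xor-rotate (ℓ u w) (weight ℓ loop) (weight ℓ rest))
    ; loop< = m<n⇒m<1+n loop< ; rest< = s≤s rest< })
    where open Shortcut s
  ... | inj₁ unique with anyᴸ? (u ≟ᶠ_) (departures W)
  ...   | no u∉ = inj₁ (¬Any⇒All¬ _ u∉ ∷ unique)
  ...   | yes u∈ with visits W u∈
  ...     | split W₁ b W₂ = inj₂ (record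
    { loop = step a W₁ ; rest = step b W₂
    ; weight-split = λ ℓ → trans (cong (ℓ u w xor_) (weight-++ ℓ W₁ (step b W₂))) (sym (xor-assoc (ℓ u w) _ _))
    ; loop< = s≤s (subst (steps W₁ <_) (sym (steps-++ W₁ (step b W₂))) (m<m+n (steps W₁) (s≤s z≤n)))
    ; rest< = s≤s (subst (steps (step b W₂) ≤_) (sym (steps-++ W₁ (step b W₂))) (m≤n+m _ (steps W₁))) })

  -- an immediate backtrack u ~ w ~ u is skipped; otherwise w has two distinct neighbours
  inner-edge-on-walk : ∀ {u v} → Walk G u v → InnerNode G u → InnerNode G v → u ≢ v → InnerEdge
  inner-edge-on-walk here                            _  _  u≢v = ⊥-elim (u≢v refl)
  inner-edge-on-walk (step {u} {w} a here)           iu iv _   = u , w , a , iu , iv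
  inner-edge-on-walk (step {u} {w} a (step {_} {w′} b W)) iu iv u≢v with w′ ≟ᶠ u
  ... | yes refl = inner-edge-on-walk W iu iv u≢v
  ... | no w′≢u  = u , w , a , iu , inner-of-two-neighbours (Adj-sym a) b (w′≢u ∘ sym)

  InnerEdge⇔AtLeastTwoInnerNodes : Connected G → InnerEdge ⇔ AtLeastTwoInnerNodes G
  InnerEdge⇔AtLeastTwoInnerNodes connected =
    mk⇔ (λ (x , y , a , ix , iy) → x , y , Adj⇒≢ a , ix , iy)
        (λ (u , v , u≢v , iu , iv) → inner-edge-on-walk (connected u v) iu iv u≢v)

  edge? : {R : Fin n → Fin n → Set} → (∀ u w → Dec (R u w)) → Dec (∃[ u ] ∃[ w ] (Adj G u w × R u w))
  edge? R? = any? λ u → any? λ w → (adj G u w ≟ᵇ true) ×-dec R? u w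

  edge-within-colour : ∀ {c} → ¬ Independent G c → ∃[ u ] ∃[ w ] (Adj G u w × c u ≡ c w)
  edge-within-colour {c} dependent with edge? (λ u w → c u ≟ᵇ c w)
  ... | yes e  = e
  ... | no ¬e = ⊥-elim (dependent λ u w a e → ¬e (u , w , a , e))

  edge-across-colours : ∀ {c} → Connected G → ¬ Monochromatic G c → ∃[ u ] ∃[ w ] (Adj G u w × c u ≢ c w)
  edge-across-colours {c} connected polychromatic with edge? (λ u w → ¬? (c u ≟ᵇ c w))
  ... | yes e  = e
  ... | no ¬e = ⊥-elim (polychromatic λ u v → constant (connected u v))
    where
      constant : ∀ {u v} → Walk G u v → c u ≡ c v
      constant here = refl
      constant (step {u} {w} a W) with c u ≟ᵇ c w
      ... | yes e   = trans e (constant W)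
      ... | no c≢ = ⊥-elim (¬e (u , w , a , c≢))

  module _ (acyclic : Acyclic G) (ℓ : Fin n → Fin n → Bool) (ℓ-sym : ∀ u v → ℓ u v ≡ ℓ v u) where

    weight-closed-path : ∀ {u} (W : Walk G u u) → Unique (departures W) → weight ℓ W ≡ false
    weight-closed-path here                          _      = refl
    weight-closed-path (step a here)                 _      = ⊥-elim (Adj⇒≢ a refl)
    weight-closed-path (step {u} {w} _ (step _ here)) _     =
      trans (cong (ℓ u w xor_) (trans (xor-identityʳ (ℓ w u)) (ℓ-sym w u))) (xor-same (ℓ u w))
    weight-closed-path W@(step _ (step _ (step _ _))) unique =
      ⊥-elim (acyclic _ (s≤s (s≤s z≤n) , unique , departures-linked W))

    -- a closed walk repeating a vertex splits into two shorter closed walks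
    weight-closed : ∀ {u} (W : Walk G u u) → weight ℓ W ≡ false
    weight-closed W = go W (<-wellFounded (steps W))
      where
        go : ∀ {u} (W : Walk G u u) → Acc _<_ (steps W) → weight ℓ W ≡ false
        go W (acc shorter) with path-or-shortcut W
        ... | inj₁ unique = weight-closed-path W unique
        ... | inj₂ s = trans (weight-split ℓ)
                             (cong₂ _xor_ (go loop (shorter loop<)) (go rest (shorter rest<)))
          where open Shortcut s

    weight-return : ∀ {u v} (W : Walk G u v) (W′ : Walk G v u) → weight ℓ W ≡ weight ℓ W′
    weight-return W W′ = xor≡false⇒≡ (trans (sym (weight-++ ℓ W W′)) (weight-closed (W ++ʷ W′)))

  MIN-dependent-fixed-point⇒InnerEdge : ∀ {c} → FixedPoint G (MIN G) c → ¬ Independent G c → InnerEdge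
  MIN-dependent-fixed-point⇒InnerEdge fixed dependent with edge-within-colour dependent
  ... | u , w , a , e =
    u , w , a , inner-of-minority (minority u) a (sym e) , inner-of-minority (minority w) (Adj-sym a) e
    where minority = Equivalence.to (MIN-fixed⇔ _) fixed

  MAJ-polychromatic-fixed-point⇒InnerEdge : ∀ {c} → Connected G →
    FixedPoint G (MAJ G) c → ¬ Monochromatic G c → InnerEdge
  MAJ-polychromatic-fixed-point⇒InnerEdge connected fixed polychromatic with edge-across-colours connected polychromatic
  ... | u , w , a , e =
    u , w , a , inner-of-minority (minority u) a (¬-not (e ∘ sym)) , inner-of-minority (minority w) (Adj-sym a) (¬-not e)
    where minority = Equivalence.to (MAJ-fixed⇔ _) fixed

  SamePair : Fin n → Fin n → Fin n → Fin n → Set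
  SamePair x y u v = (u ≡ x × v ≡ y) ⊎ (u ≡ y × v ≡ x)

  samePair? : ∀ x y u v → Dec (SamePair x y u v)
  samePair? x y u v = (u ≟ᶠ x ×-dec v ≟ᶠ y) ⊎-dec (u ≟ᶠ y ×-dec v ≟ᶠ x)

  SamePair-comm : ∀ {x y u v} → SamePair x y u v → SamePair y x u v
  SamePair-comm = [ inj₂ , inj₁ ]

  SamePair-sym : ∀ {x y u v} → SamePair x y u v → SamePair x y v u
  SamePair-sym = [ inj₂ ∘ swap , inj₁ ∘ swap ]

  SamePair-partner : ∀ {x y u} → SamePair x y x u → u ≡ y
  SamePair-partner (inj₁ (_ , u≡y))   = u≡y
  SamePair-partner (inj₂ (x≡y , u≡x)) = trans u≡x x≡y

  pairIndicator : Fin n → Fin n → Fin n → Fin n → Bool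
  pairIndicator x y u v = does (samePair? x y u v)

  pairIndicator-sym : ∀ x y u v → pairIndicator x y u v ≡ pairIndicator x y v u
  pairIndicator-sym x y u v = does-⇔ (mk⇔ SamePair-sym SamePair-sym) (samePair? x y u v) (samePair? x y v u)

  pairIndicator-refl : ∀ x y → pairIndicator x y x y ≡ true
  pairIndicator-refl x y = dec-true (samePair? x y x y) (inj₁ (refl , refl))

  module _ {c : Coloring G} {i : Bool} {x y : Fin n} (ix : InnerNode G x) (iy : InnerNode G y) where

    minority-of-crossing-only : ∀ {v} → (∀ u → Adj G v u → c u ≡ i → SamePair x y v u) → InMinority c i v
    minority-of-crossing-only {v} crossing with v ≟ᶠ x | v ≟ᶠ y
    ... | yes refl | _        = minority-of-inner ix λ u a e → SamePair-partner (crossing u a e)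
    ... | no _     | yes refl = minority-of-inner iy λ u a e → SamePair-partner (SamePair-comm (crossing u a e))
    ... | no v≢x   | no v≢y   = minority-of-absent λ u a e → [ v≢x ∘ proj₁ , v≢y ∘ proj₁ ] (crossing u a e)

  module _ (tree : IsTree G) where
    private
      connected = proj₁ (proj₂ tree)
      acyclic   = proj₂ (proj₂ tree)
      root      = fromℕ< (proj₁ tree)

    potential : (Fin n → Fin n → Bool) → Coloring G
    potential ℓ v = weight ℓ (connected root v)

    potential-xor : ∀ ℓ → (∀ u v → ℓ u v ≡ ℓ v u) →
      ∀ {u v} → Adj G u v → potential ℓ u xor potential ℓ v ≡ ℓ u v
    potential-xor ℓ ℓ-sym {u} {v} a = sym (xor≡false⇒≡ (begin
        ℓ u v xor (potential ℓ u xor potential ℓ v)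
      ≡⟨ xor-rotate (ℓ u v) (potential ℓ u) _ ⟩
        potential ℓ u xor (ℓ u v xor potential ℓ v)
      ≡⟨ cong (λ p → potential ℓ u xor (ℓ u v xor p))
              (weight-return acyclic ℓ ℓ-sym (connected root v) (connected v root)) ⟩
        weight ℓ (connected root u) xor weight ℓ (step a (connected v root))
      ≡⟨ sym (weight-++ ℓ (connected root u) _) ⟩
        weight ℓ (connected root u ++ʷ step a (connected v root))
      ≡⟨ weight-closed acyclic ℓ ℓ-sym (connected root u ++ʷ step a (connected v root)) ⟩
        false ∎))
      where open ≡-Reasoning

    MIN-independent-fixed-point : ∃[ c ] (FixedPoint G (MIN G) c × Independent G c)
    MIN-independent-fixed-point =
      c , Equivalence.from (MIN-fixed⇔ c) (λ v → minority-of-absent λ u a → flips a ∘ sym) , λ _ _ → flips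
      where
        c = potential (λ _ _ → true)
        flips : ∀ {u v} → Adj G u v → c u ≢ c v
        flips a = xor≡true⇒≢ (potential-xor _ (λ _ _ → refl) a)

    InnerEdge⇒MIN-dependent-fixed-point : InnerEdge → ∃[ c ] (FixedPoint G (MIN G) c × ¬ Independent G c)
    InnerEdge⇒MIN-dependent-fixed-point (x , y , a , ix , iy) =
      c , Equivalence.from (MIN-fixed⇔ c) (λ v → minority-of-crossing-only ix iy λ u → crossing) ,
      λ independent → independent x y a (xor≡false⇒≡ (trans (flips a) (cong not (pairIndicator-refl x y))))
      where
        ℓ = λ u v → not (pairIndicator x y u v)
        c = potential ℓ
        flips : ∀ {u v} → Adj G u v → c u xor c v ≡ not (pairIndicator x y u v)
        flips = potential-xor ℓ λ u v → cong not (pairIndicator-sym x y u v)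
        crossing : ∀ {v u} → Adj G v u → c u ≡ c v → SamePair x y v u
        crossing {v} {u} b e = does-true⇒ (samePair? x y v u)
          (not-injective (trans (sym (flips b)) (trans (cong (c v xor_) e) (xor-same (c v)))))

    MAJ-monochromatic-fixed-point : ∃[ c ] (FixedPoint G (MAJ G) c × Monochromatic G c)
    MAJ-monochromatic-fixed-point =
      (λ _ → false) , Equivalence.from (MAJ-fixed⇔ _) (λ v → minority-of-absent λ _ _ ()) , λ _ _ → refl

    InnerEdge⇒MAJ-polychromatic-fixed-point : InnerEdge → ∃[ c ] (FixedPoint G (MAJ G) c × ¬ Monochromatic G c)
    InnerEdge⇒MAJ-polychromatic-fixed-point (x , y , a , ix , iy) =
      c , Equivalence.from (MAJ-fixed⇔ c) (λ v → minority-of-crossing-only ix iy λ u → crossing) ,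
      λ monochromatic → xor≡true⇒≢ (trans (flips a) (pairIndicator-refl x y)) (monochromatic x y)
      where
        c = potential (pairIndicator x y)
        flips : ∀ {u v} → Adj G u v → c u xor c v ≡ pairIndicator x y u v
        flips = potential-xor (pairIndicator x y) (pairIndicator-sym x y)
        crossing : ∀ {v u} → Adj G v u → c u ≡ not (c v) → SamePair x y v u
        crossing {v} {u} b e = does-true⇒ (samePair? x y v u)
          (trans (sym (flips b)) (trans (cong (c v xor_) e) (xor-inverseʳ (c v))))

    MIN-dependent-fixed-point⇔InnerEdge : (∃[ c ] (FixedPoint G (MIN G) c × ¬ Independent G c)) ⇔ InnerEdge
    MIN-dependent-fixed-point⇔InnerEdge =
      mk⇔ (λ (_ , fixed , dependent) → MIN-dependent-fixed-point⇒InnerEdge fixed dependent)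
          InnerEdge⇒MIN-dependent-fixed-point

    MAJ-polychromatic-fixed-point⇔InnerEdge : (∃[ c ] (FixedPoint G (MAJ G) c × ¬ Monochromatic G c)) ⇔ InnerEdge
    MAJ-polychromatic-fixed-point⇔InnerEdge =
      mk⇔ (λ (_ , fixed , polychromatic) → MAJ-polychromatic-fixed-point⇒InnerEdge connected fixed polychromatic)
          InnerEdge⇒MAJ-polychromatic-fixed-point

corollary4 : ∀ {n : ℕ} (T : Graph n) → IsTree T →
    (∃[ c ] (FixedPoint T (MIN T) c × Independent T c))
    × ((∃[ c ] (FixedPoint T (MIN T) c × ¬ Independent T c)) ⇔ AtLeastTwoInnerNodes T)
    × (∃[ c ] (FixedPoint T (MAJ T) c × Monochromatic T c))
    × ((∃[ c ] (FixedPoint T (MAJ T) c × ¬ Monochromatic T c)) ⇔ AtLeastTwoInnerNodes T)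
corollary4 T tree@(_ , connected , _) =
    MIN-independent-fixed-point T tree
  , ⇔-trans (MIN-dependent-fixed-point⇔InnerEdge T tree) (InnerEdge⇔AtLeastTwoInnerNodes T connected)
  , MAJ-monochromatic-fixed-point T tree
  , ⇔-trans (MAJ-polychromatic-fixed-point⇔InnerEdge T tree) (InnerEdge⇔AtLeastTwoInnerNodes T connected)
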